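{- Let $r,s\in\mathbb N$ with $r\ge 2s+1$, and let $a_1,\dots,a_{2s}\in[1,r-1]$ with $a_i<a_{i+1}$ for $i=1,\dots,2s-1$. Let $x_1=a_1$, $x_i=\sum_{j=0}^{i-1}a_{2j+1}-\sum_{j=1}^{i-1}a_{2j}$ for $i=2,\dots,s$, and $y_i=\sum_{j=0}^{i-1}a_{2j+1}-\sum_{j=1}^{i}a_{2j}+r$ for $i=1,\dots,s$. Then $0<x_1<\dots<x_s<y_s<\dots<y_1<r$ and the residue classes of $0,x_1,\dots,x_s,y_1,\dots,y_s$ in $\mathbb Z_r$ are pairwise distinct.
   Context: $\mathbb N=\{0,1,2,\dots\}$; $[a,b]=\{x\in\mathbb N: a\le x\le b\}$. -}

module Defs where

open import Data.Nat using (ℕ; zero; suc; _∸_) renaming (_+_ to _+ℕ_; _*_ to _*ℕ_)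
open import Data.Integer using (ℤ; +_; _+_; _-_; 0ℤ)

-- sumRange lo hi f = Σ_{j = lo}^{hi} f j  (empty, i.e. 0, when hi < lo)
sumRange : ℕ → ℕ → (ℕ → ℤ) → ℤ
sumRange lo hi f = go (suc hi ∸ lo)
  where
  go : ℕ → ℤ
  go zero    = 0ℤ
  go (suc k) = go k + f (lo +ℕ k)

-- The sequence a is 1-indexed: a 1, ..., a (2s) are the a_1, ..., a_{2s}.
-- x_i = Σ_{j=0}^{i-1} a_{2j+1} - Σ_{j=1}^{i-1} a_{2j}
xSeq : (ℕ → ℕ) → ℕ → ℤ
xSeq a i = sumRange 0 (i ∸ 1) (λ j → + a (suc (2 *ℕ j)))
         - sumRange 1 (i ∸ 1) (λ j → + a (2 *ℕ j))

ySeq : ℕ → (ℕ → ℕ) → ℕ → ℤ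
ySeq r a i = sumRange 0 (i ∸ 1) (λ j → + a (suc (2 *ℕ j)))
           - sumRange 1 i (λ j → + a (2 *ℕ j))
           + + r

infix 4 _≡[mod_]_
_≡[mod_]_ : ℤ → ℕ → ℤ → Set
u ≡[mod r ] v = (+ r) Data.Integer.Divisibility.∣ (u - v)
  where import Data.Integer.Divisibility

{-# OPTIONS --safe #-}
module Submission where

-- Telescoping the sums gives x₁ = a₁, x_{i+1} = xᵢ + (a_{2i+1} − a_{2i}), yᵢ = xᵢ + (r − a_{2i})
-- and y_{i+1} = yᵢ + (a_{2i+1} − a_{2i+2}), with y₁ = r + (a₁ − a₂).  Since the aⱼ increase
-- and stay in [1, r − 1], the xᵢ increase from x₁ > 0, the yᵢ decrease to y₁ < r, and
-- x_s < y_s.  So 0, x₁, …, x_s, y_s, …, y₁ are distinct integers in [0, r), and distinct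
-- elements of [0, r) are incongruent modulo r.

open import Defs
open import Data.Nat using (ℕ; suc; _≤_; _<_; _∸_; _*_)
open import Data.Integer using (ℤ; +_) renaming (_<_ to _<ℤ_)
open import Data.Product using (_×_)
open import Relation.Nullary using (¬_)
open import Relation.Binary.PropositionalEquality using (_≢_)

open import Data.Nat using (zero; z≤n; s≤s; _⊔_)
open import Data.Nat.Divisibility using (_∣_; >⇒∤)
import Data.Nat.Properties as ℕ
open import Data.Integer using (_+_; _-_; -_; 0ℤ; +≤+; +<+; ∣_∣; _⊖_)
  renaming (_≤_ to _≤ℤ_; _≥_ to _≥ℤ_)
import Data.Integer.Properties as ℤ
open import Data.Integer.Tactic.RingSolver using (solve-∀)
open import Data.Product using (_,_; proj₁; proj₂)
open import Data.Sum using (inj₁; inj₂)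
open import Level using (Level)
open import Relation.Binary.Core using (Rel; _⇒_)
open import Relation.Binary.Definitions using (Reflexive; Transitive; Irreflexive; tri<; tri≈; tri>)
open import Relation.Binary.PropositionalEquality using (_≡_; refl; sym; cong; subst)
open import Relation.Nullary using (contradiction)
open import Function.Base using (_∘_)

module StepwiseMonotone {a ℓ₁ ℓ₂ : Level} {A : Set a} {_≼_ : Rel A ℓ₁} {_≺_ : Rel A ℓ₂}
    (≼-refl : Reflexive _≼_) (≺⇒≼ : _≺_ ⇒ _≼_)
    (≺-trans : Transitive _≺_) (≺-irrefl : Irreflexive _≡_ _≺_)
    (f : ℕ → A) {lo hi : ℕ} (step : ∀ i → lo ≤ i → suc i ≤ hi → f i ≺ f (suc i)) where

  strict : ∀ {i j} → lo ≤ i → i < j → j ≤ hi → f i ≺ f j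
  strict {i} {suc j} lo≤i i<1+j 1+j≤hi with ℕ.m<1+n⇒m<n∨m≡n i<1+j
  ... | inj₁ i<j  = ≺-trans (strict lo≤i i<j (ℕ.<⇒≤ 1+j≤hi))
                            (step j (ℕ.≤-trans lo≤i (ℕ.<⇒≤ i<j)) 1+j≤hi)
  ... | inj₂ refl = step i lo≤i 1+j≤hi

  weak : ∀ {i j} → lo ≤ i → i ≤ j → j ≤ hi → f i ≼ f j
  weak lo≤i i≤j j≤hi with ℕ.m≤n⇒m<n∨m≡n i≤j
  ... | inj₁ i<j  = ≺⇒≼ (strict lo≤i i<j j≤hi)
  ... | inj₂ refl = ≼-refl

  injective : ∀ {i j} → lo ≤ i → i ≤ hi → lo ≤ j → j ≤ hi → f i ≡ f j → i ≡ j
  injective {i} {j} lo≤i i≤hi lo≤j j≤hi fi≡fj with ℕ.<-cmp i j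
  ... | tri< i<j _ _ = contradiction (strict lo≤i i<j j≤hi) (≺-irrefl fi≡fj)
  ... | tri≈ _ i≡j _ = i≡j
  ... | tri> _ _ j<i = contradiction (strict lo≤j j<i i≤hi) (≺-irrefl (sym fi≡fj))

j<k⇒i<i+[k-j] : ∀ {i j k} → j <ℤ k → i <ℤ i + (k - j)
j<k⇒i<i+[k-j] {i} {j} {k} j<k = subst (_<ℤ i + (k - j)) (ℤ.+-identityʳ i) (ℤ.+-monoʳ-< i 0<k-j)
  where
  0<k-j : 0ℤ <ℤ k - j
  0<k-j = subst (_<ℤ k - j) (ℤ.+-inverseʳ j) (ℤ.+-monoˡ-< (- j) j<k)

j<k⇒i+[j-k]<i : ∀ {i j k} → j <ℤ k → i + (j - k) <ℤ i
j<k⇒i+[j-k]<i {i} {j} {k} j<k = subst (i + (j - k) <ℤ_) (ℤ.+-identityʳ i) (ℤ.+-monoʳ-< i j-k<0)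
  where
  j-k<0 : j - k <ℤ 0ℤ
  j-k<0 = subst (j - k <ℤ_) (ℤ.+-inverseʳ k) (ℤ.+-monoˡ-< (- k) j<k)

∣∧<⇒≡0 : ∀ {m n} → m ∣ n → n < m → n ≡ 0
∣∧<⇒≡0 {n = zero}  _   _   = refl
∣∧<⇒≡0 {n = suc _} m∣n n<m = contradiction m∣n (>⇒∤ n<m)

0≤_<_ : ℤ → ℕ → Set
0≤ u < r = 0ℤ ≤ℤ u × u <ℤ + r

≡[mod]⇒≡ : ∀ {r u v} → 0≤ u < r → 0≤ v < r → u ≡[mod r ] v → u ≡ v
≡[mod]⇒≡ {r} (+≤+ {n = m} _ , +<+ m<r) (+≤+ {n = n} _ , +<+ n<r) r∣u-v =
  ℤ.i-j≡0⇒i≡j (+ m) (+ n) (ℤ.∣i∣≡0⇒i≡0 (∣∧<⇒≡0 r∣u-v ∣u-v∣<r))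
  where
  open ℕ.≤-Reasoning
  ∣u-v∣<r : ∣ + m - + n ∣ < r
  ∣u-v∣<r = begin-strict
    ∣ + m - + n ∣ ≡⟨ cong ∣_∣ (ℤ.m-n≡m⊖n m n) ⟩
    ∣ m ⊖ n ∣     ≤⟨ ℤ.∣m⊝n∣≤m⊔n m n ⟩
    m ⊔ n         <⟨ ℕ.⊔-lub m<r n<r ⟩
    r             ∎

<⇒≢[mod] : ∀ {r u v} → 0ℤ ≤ℤ u → u <ℤ v → v <ℤ + r → ¬ (u ≡[mod r ] v)
<⇒≢[mod] 0≤u u<v v<r =
  ℤ.<⇒≢ u<v ∘ ≡[mod]⇒≡ (0≤u , ℤ.<-trans u<v v<r) (ℤ.≤-trans 0≤u (ℤ.<⇒≤ u<v) , v<r)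

module Recurrences (a : ℕ → ℕ) where

  private
    oddSum evenSum : ℕ → ℤ
    oddSum  k = sumRange 0 k (λ j → + a (suc (2 * j)))
    evenSum k = sumRange 1 k (λ j → + a (2 * j))

  xSeq-one : xSeq a 1 ≡ + a 1
  xSeq-one = ℤ.+-identityʳ (+ a 1)

  -- Truncated subtraction makes xSeq a 0 = a 1, hence the side condition 1 ≤ i.
  xSeq-suc : ∀ i → 1 ≤ i → xSeq a (suc i) ≡ xSeq a i + (+ a (suc (2 * i)) - + a (2 * i))
  xSeq-suc (suc k) _ = regroup (oddSum k) (evenSum k) (+ a (suc (2 * suc k))) (+ a (2 * suc k))
    where
    regroup : ∀ o e p q → (o + p) - (e + q) ≡ (o - e) + (p - q)
    regroup = solve-∀

  ySeq≡xSeq+[r-a] : ∀ r i → 1 ≤ i → ySeq r a i ≡ xSeq a i + (+ r - + a (2 * i))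
  ySeq≡xSeq+[r-a] r (suc k) _ = regroup (oddSum k) (evenSum k) (+ a (2 * suc k)) (+ r)
    where
    regroup : ∀ o e q r → o - (e + q) + r ≡ (o - e) + (r - q)
    regroup = solve-∀

  ySeq-one : ∀ r → ySeq r a 1 ≡ + r + (+ a 1 - + a 2)
  ySeq-one r = regroup (+ a 1) (+ a 2) (+ r)
    where
    regroup : ∀ p q r → (0ℤ + p) - (0ℤ + q) + r ≡ r + (p - q)
    regroup = solve-∀

  ySeq-suc : ∀ r i → 1 ≤ i → ySeq r a (suc i) ≡ ySeq r a i + (+ a (suc (2 * i)) - + a (2 * suc i))
  ySeq-suc r (suc k) _ =
    regroup (oddSum k) (evenSum k) (+ a (suc (2 * suc k))) (+ a (2 * suc k)) (+ a (2 * suc (suc k))) (+ r)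
    where
    regroup : ∀ o e p q q′ r → (o + p) - ((e + q) + q′) + r ≡ (o - (e + q) + r) + (p - q′)
    regroup = solve-∀

≤∸1⇒< : ∀ {m n} → 1 ≤ m → m ≤ n ∸ 1 → m < n
≤∸1⇒< {n = zero}  (s≤s _) ()
≤∸1⇒< {n = suc _} _       m≤n = s≤s m≤n

module Interlacing (r s : ℕ) (a : ℕ → ℕ)
    (bounded : ∀ i → 1 ≤ i → i ≤ 2 * s → 1 ≤ a i × a i ≤ r ∸ 1)
    (increasing : ∀ i → 1 ≤ i → suc i ≤ 2 * s → a i < a (suc i)) where

  open Recurrences a

  private
    2+2i≤2s : ∀ {i} → suc i ≤ s → suc (suc (2 * i)) ≤ 2 * s
    2+2i≤2s {i} 1+i≤s = subst (_≤ 2 * s) (ℕ.*-suc 2 i) (ℕ.*-monoʳ-≤ 2 1+i≤s)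

    1≤2i : ∀ {i} → 1 ≤ i → 1 ≤ 2 * i
    1≤2i = ℕ.m≤n⇒m≤o*n 2

  a<r : ∀ i → 1 ≤ i → i ≤ 2 * s → a i < r
  a<r i 1≤i i≤2s = let 1≤aᵢ , aᵢ≤r-1 = bounded i 1≤i i≤2s in ≤∸1⇒< 1≤aᵢ aᵢ≤r-1

  x-step : ∀ i → 1 ≤ i → suc i ≤ s → xSeq a i <ℤ xSeq a (suc i)
  x-step i 1≤i 1+i≤s = subst (xSeq a i <ℤ_) (sym (xSeq-suc i 1≤i))
    (j<k⇒i<i+[k-j] (+<+ (increasing (2 * i) (1≤2i 1≤i) (ℕ.<⇒≤ (2+2i≤2s 1+i≤s)))))

  y-step : ∀ i → 1 ≤ i → suc i ≤ s → ySeq r a (suc i) <ℤ ySeq r a i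
  y-step i 1≤i 1+i≤s = subst (_<ℤ ySeq r a i) (sym (ySeq-suc r i 1≤i))
    (j<k⇒i+[j-k]<i (+<+ a₂ᵢ₊₁<a₂ᵢ₊₂))
    where
    a₂ᵢ₊₁<a₂ᵢ₊₂ : a (suc (2 * i)) < a (2 * suc i)
    a₂ᵢ₊₁<a₂ᵢ₊₂ = subst (λ m → a (suc (2 * i)) < a m) (sym (ℕ.*-suc 2 i))
      (increasing (suc (2 * i)) (s≤s z≤n) (2+2i≤2s 1+i≤s))

  xᵢ<yᵢ : ∀ i → 1 ≤ i → i ≤ s → xSeq a i <ℤ ySeq r a i
  xᵢ<yᵢ i 1≤i i≤s = subst (xSeq a i <ℤ_) (sym (ySeq≡xSeq+[r-a] r i 1≤i))
    (j<k⇒i<i+[k-j] (+<+ (a<r (2 * i) (1≤2i 1≤i) (ℕ.*-monoʳ-≤ 2 i≤s))))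

  0<x₁ : 1 ≤ s → 0ℤ <ℤ xSeq a 1
  0<x₁ 1≤s = subst (0ℤ <ℤ_) (sym xSeq-one) (+<+ (proj₁ (bounded 1 ℕ.≤-refl (1≤2i 1≤s))))

  y₁<r : 1 ≤ s → ySeq r a 1 <ℤ + r
  y₁<r 1≤s = subst (_<ℤ + r) (sym (ySeq-one r))
    (j<k⇒i+[j-k]<i (+<+ (increasing 1 ℕ.≤-refl (ℕ.*-monoʳ-≤ 2 1≤s))))

  module X = StepwiseMonotone {_≼_ = _≤ℤ_} ℤ.≤-refl ℤ.<⇒≤ ℤ.<-trans ℤ.<-irrefl (xSeq a) x-step
  module Y = StepwiseMonotone {_≼_ = _≥ℤ_} ℤ.≤-refl ℤ.<⇒≤ (λ p q → ℤ.<-trans q p) ℤ.>-irrefl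
               (ySeq r a) y-step

  0<xᵢ : ∀ i → 1 ≤ i → i ≤ s → 0ℤ <ℤ xSeq a i
  0<xᵢ i 1≤i i≤s = ℤ.<-≤-trans (0<x₁ (ℕ.≤-trans 1≤i i≤s)) (X.weak ℕ.≤-refl 1≤i i≤s)

  yⱼ<r : ∀ j → 1 ≤ j → j ≤ s → ySeq r a j <ℤ + r
  yⱼ<r j 1≤j j≤s = ℤ.≤-<-trans (Y.weak ℕ.≤-refl 1≤j j≤s) (y₁<r (ℕ.≤-trans 1≤j j≤s))

  xᵢ<yⱼ : ∀ i j → 1 ≤ i → i ≤ s → 1 ≤ j → j ≤ s → xSeq a i <ℤ ySeq r a j
  xᵢ<yⱼ i j 1≤i i≤s 1≤j j≤s = ℤ.≤-<-trans (X.weak 1≤i i≤s ℕ.≤-refl)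
    (ℤ.<-≤-trans (xᵢ<yᵢ s (ℕ.≤-trans 1≤i i≤s) ℕ.≤-refl) (Y.weak 1≤j j≤s ℕ.≤-refl))

  0<yⱼ : ∀ j → 1 ≤ j → j ≤ s → 0ℤ <ℤ ySeq r a j
  0<yⱼ j 1≤j j≤s = ℤ.<-trans (0<xᵢ j 1≤j j≤s) (xᵢ<yᵢ j 1≤j j≤s)

  0≤xᵢ<r : ∀ i → 1 ≤ i → i ≤ s → 0≤ xSeq a i < r
  0≤xᵢ<r i 1≤i i≤s = ℤ.<⇒≤ (0<xᵢ i 1≤i i≤s) , ℤ.<-trans (xᵢ<yᵢ i 1≤i i≤s) (yⱼ<r i 1≤i i≤s)

  0≤yⱼ<r : ∀ j → 1 ≤ j → j ≤ s → 0≤ ySeq r a j < r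
  0≤yⱼ<r j 1≤j j≤s = ℤ.<⇒≤ (0<yⱼ j 1≤j j≤s) , yⱼ<r j 1≤j j≤s

  x-residues-distinct : ∀ i j → 1 ≤ i → i ≤ s → 1 ≤ j → j ≤ s → i ≢ j
    → ¬ (xSeq a i ≡[mod r ] xSeq a j)
  x-residues-distinct i j 1≤i i≤s 1≤j j≤s i≢j =
    i≢j ∘ X.injective 1≤i i≤s 1≤j j≤s ∘ ≡[mod]⇒≡ (0≤xᵢ<r i 1≤i i≤s) (0≤xᵢ<r j 1≤j j≤s)

  y-residues-distinct : ∀ i j → 1 ≤ i → i ≤ s → 1 ≤ j → j ≤ s → i ≢ j
    → ¬ (ySeq r a i ≡[mod r ] ySeq r a j)
  y-residues-distinct i j 1≤i i≤s 1≤j j≤s i≢j =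
    i≢j ∘ Y.injective 1≤i i≤s 1≤j j≤s ∘ ≡[mod]⇒≡ (0≤yⱼ<r i 1≤i i≤s) (0≤yⱼ<r j 1≤j j≤s)

lemma3 : (r s : ℕ) → suc (2 * s) ≤ r → (a : ℕ → ℕ)
    → (∀ i → 1 ≤ i → i ≤ 2 * s → 1 ≤ a i × a i ≤ r ∸ 1)
    → (∀ i → 1 ≤ i → suc i ≤ 2 * s → a i < a (suc i))
    → ((1 ≤ s → (+ 0 <ℤ xSeq a 1)
                × (xSeq a s <ℤ ySeq r a s)
                × (ySeq r a 1 <ℤ + r))
      × (∀ i → 1 ≤ i → suc i ≤ s → xSeq a i <ℤ xSeq a (suc i))
      × (∀ i → 1 ≤ i → suc i ≤ s → ySeq r a (suc i) <ℤ ySeq r a i))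
    × ((∀ i → 1 ≤ i → i ≤ s → ¬ (+ 0 ≡[mod r ] xSeq a i))
      × (∀ i → 1 ≤ i → i ≤ s → ¬ (+ 0 ≡[mod r ] ySeq r a i))
      × (∀ i j → 1 ≤ i → i ≤ s → 1 ≤ j → j ≤ s → i ≢ j → ¬ (xSeq a i ≡[mod r ] xSeq a j))
      × (∀ i j → 1 ≤ i → i ≤ s → 1 ≤ j → j ≤ s → i ≢ j → ¬ (ySeq r a i ≡[mod r ] ySeq r a j))
      × (∀ i j → 1 ≤ i → i ≤ s → 1 ≤ j → j ≤ s → ¬ (xSeq a i ≡[mod r ] ySeq r a j)))
lemma3 r s _ a bounded increasing =
    ( (λ 1≤s → 0<x₁ 1≤s , xᵢ<yᵢ s 1≤s ℕ.≤-refl , y₁<r 1≤s)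
    , x-step
    , y-step )
  , ( (λ i 1≤i i≤s → <⇒≢[mod] ℤ.≤-refl (0<xᵢ i 1≤i i≤s) (proj₂ (0≤xᵢ<r i 1≤i i≤s)))
    , (λ j 1≤j j≤s → <⇒≢[mod] ℤ.≤-refl (0<yⱼ j 1≤j j≤s) (yⱼ<r j 1≤j j≤s))
    , x-residues-distinct
    , y-residues-distinct
    , λ i j 1≤i i≤s 1≤j j≤s →
        <⇒≢[mod] (ℤ.<⇒≤ (0<xᵢ i 1≤i i≤s)) (xᵢ<yⱼ i j 1≤i i≤s 1≤j j≤s) (yⱼ<r j 1≤j j≤s) )
  where open Interlacing r s a bounded increasing
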